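{- Let $G$ be a graph, $P$ a non-trivial prime graph in a split decomposition of $G$, $k$ a positive integer, and $(T,\delta)$ a branch decomposition of $G$ of sm-width less than $k$. Let $a \in V(P)$ and let $(X,Y)$ be a cut of $G$ induced by an edge of $T$. If $|X \cap \operatorname{act}(a:P)| \geq k$ and $|Y \cap \operatorname{act}(N_P(a):P)| \geq k$, then $(X,Y)$ is a split of $G$.
   Context: All graphs are finite, simple and undirected. For $S \subseteq V(G)$, $N_G(S) = \bigcup_{a\in S} N_G(a) \setminus S$, and $\bar S = V(G)\setminus S$. A split of a connected graph $G$ is a partition $(V_1,V_2)$ of $V(G)$ with $|V_1|,|V_2| \geq 2$ such that every vertex of $V_1$ having a neighbour in $V_2$ has the same neighbourhood in $V_2$. Split decomposition: if $(V_1,V_2)$ is a split, $G$ is decomposed into $G_1 = G[V_1]$ plus a new marker vertex $v$ adjacent exactly to $N_G(V_2)$, and $G_2 = G[V_2]$ plus the same marker $v$ adjacent exactly to $N_G(V_1)$. A graph with no split is prime; non-trivial if it has more than three vertices. A split decomposition of $G$ recursively decomposes until all graphs $G_1,\dots,G_q$ are prime; each marker lies in exactly two prime graphs; the split decomposition tree has a node per prime graph, adjacent iff they share a marker. For a prime graph $G_i$ and $v\in V(G_i)$: $\operatorname{tot}(v:G_i)=\{v\}$ if $v\in V(G)$, and otherwise (with $G_j\neq G_i$ the other prime graph containing marker $v$) $\operatorname{tot}(v:G_i)$ is the set of vertices of $V(G)$ in the prime graphs of the component of the tree minus node $G_i$ containing $G_j$. $\operatorname{act}(v:G_i) = N_G(V(G)\setminus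 \operatorname{tot}(v:G_i))$; for $V'\subseteq V(G_i)$, $\operatorname{act}(V':G_i)=\bigcup_{v\in V'}\operatorname{act}(v:G_i)$. $N_P(a)$ is the neighbourhood of $a$ in $P$. For $A\subseteq V(G)$, $\operatorname{mm}(A)$ is the maximum size of a matching in the bipartite graph of edges of $G$ between $A$ and $\bar A$, and $\operatorname{sm}(A)=1$ if $(A,\bar A)$ is a split of $G$, otherwise $\operatorname{sm}(A)=\operatorname{mm}(A)$. A branch decomposition $(T,\delta)$ of $G$ is a tree $T$ of maximum degree 3 with a bijection $\delta$ from the leaves of $T$ to $V(G)$; each edge $e$ of $T$ induces the cut $(X,\bar X)$ of $G$ where $X$ is the image under $\delta$ of the leaves of one component of $T-e$. The sm-width of $(T,\delta)$ is the maximum of $\operatorname{sm}(X)$ over all cuts induced by edges of $T$. -}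

module Defs where

open import Level using (Level; 0ℓ) renaming (suc to lsuc)
open import Data.Nat using (ℕ; _≤_; _<_; _≤ᵇ_)
open import Data.Bool using (Bool; true; false; not; T)
open import Data.Fin using (Fin)
open import Data.Fin.Subset using (∣_∣)
open import Data.Vec using (tabulate)
open import Data.List using (List; []; _∷_; _++_; length; map)
open import Data.List.Relation.Unary.All using (All)
open import Data.List.Relation.Unary.Linked using (Linked)
open import Data.List.Relation.Unary.Unique.Propositional using (Unique)
open import Data.Product using (Σ; ∃; _×_; _,_; proj₁; proj₂)
open import Data.Sum using (_⊎_; inj₁; inj₂)
open import Data.Unit using (⊤; tt)
open import Data.Empty using (⊥)
open import Relation.Nullary using (¬_)
open import Relation.Binary.PropositionalEquality using (_≡_)
open import Relation.Binary.Construct.Closure.ReflexiveTransitive using (Star)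
open import Function.Bundles using (_⤖_; Bijection)

AtLeast : {V : Set} → ℕ → (V → Set) → Set
AtLeast {V} k S = Σ (List V) λ xs → Unique xs × All S xs × k ≤ length xs

HasNbrIn : {V : Set} → (V → V → Set) → V → (V → Set) → Set
HasNbrIn {V} Adj x S = Σ V λ z → S z × Adj x z

IsSplit : (V : Set) → (V → V → Set) → (V → Set) → Set
IsSplit V Adj V1 =
  AtLeast 2 V1 × AtLeast 2 V2 ×
  (∀ x y → V1 x → V1 y → HasNbrIn Adj x V2 → HasNbrIn Adj y V2 →
     ∀ z → V2 z → (Adj x z → Adj y z) × (Adj y z → Adj x z))
  where
  V2 : V → Set
  V2 x = ¬ V1 x

record Graph : Set where
  field
    n      : ℕ
    adj    : Fin n → Fin n → Bool
    sym    : ∀ x y → adj x y ≡ adj y x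
    irrefl : ∀ x → adj x x ≡ false
open Graph public

Adj : (G : Graph) → Fin (n G) → Fin (n G) → Set
Adj G x y = T (adj G x y)

data Reach {m : ℕ} (R : Fin m → Fin m → Set) : Fin m → Fin m → Set where
  here : ∀ {x} → Reach R x x
  step : ∀ {x y z} → R x y → Reach R y z → Reach R x z

Connected : Graph → Set
Connected G = ∀ x y → Reach (Adj G) x y

HasCycle : Graph → Set
HasCycle G = Σ (Fin (n G)) λ x → Σ (List (Fin (n G))) λ ys →
  2 ≤ length ys × Unique (x ∷ ys) × Linked (Adj G) (x ∷ ys ++ x ∷ [])

IsTree : Graph → Set
IsTree G = Connected G × ¬ HasCycle G

degree : (G : Graph) → Fin (n G) → ℕ
degree G v = ∣ tabulate (adj G v) ∣

IsLeaf : (G : Graph) → Fin (n G) → Set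
IsLeaf G v = T (degree G v ≤ᵇ 1)

Leaf : Graph → Set
Leaf G = Σ (Fin (n G)) (IsLeaf G)

record BranchDecomposition (G : Graph) : Set where
  field
    Tr     : Graph
    tree   : IsTree Tr
    maxdeg : ∀ v → degree Tr v ≤ 3
    δ      : Leaf Tr ⤖ Fin (n G)
open BranchDecomposition public

AdjMinus : (T' : Graph) → Fin (n T') → Fin (n T') → Fin (n T') → Fin (n T') → Set
AdjMinus T' p q u v = Adj T' u v × ¬ ((u ≡ p × v ≡ q) ⊎ (u ≡ q × v ≡ p))

-- the side X of the cut induced by the edge {p,q} of T: the images under δ
-- of the leaves in the component of T - pq containing p
CutSide : (G : Graph) (B : BranchDecomposition G) → Fin (n (Tr B)) → Fin (n (Tr B)) →
          Fin (n G) → Set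
CutSide G B p q g = Σ (Leaf (Tr B)) λ l →
  Bijection.to (δ B) l ≡ g × Reach (AdjMinus (Tr B) p q) p (proj₁ l)

IsMatching : (G : Graph) → (Fin (n G) → Set) → List (Fin (n G) × Fin (n G)) → Set
IsMatching G A M =
  All (λ e → A (proj₁ e) × ¬ A (proj₂ e) × Adj G (proj₁ e) (proj₂ e)) M ×
  Unique (map proj₁ M) × Unique (map proj₂ M)

IsMM : (G : Graph) → (Fin (n G) → Set) → ℕ → Set
IsMM G A m =
  (Σ (List (Fin (n G) × Fin (n G))) λ M → IsMatching G A M × length M ≡ m) ×
  (∀ M → IsMatching G A M → length M ≤ m)

IsSplitG : (G : Graph) → (Fin (n G) → Set) → Set
IsSplitG G A = IsSplit (Fin (n G)) (Adj G) A

IsSM : (G : Graph) → (Fin (n G) → Set) → ℕ → Set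
IsSM G A s = (IsSplitG G A × s ≡ 1) ⊎ (¬ IsSplitG G A × IsMM G A s)

SmWidthLess : (G : Graph) → BranchDecomposition G → ℕ → Set
SmWidthLess G B k = ∀ p q → Adj (Tr B) p q → ∀ s → IsSM G (CutSide G B p q) s → s < k

-- Split decomposition.  Each graph arising in the process is recorded
-- with its vertex type, adjacency and, for every vertex v, the set
-- tot(v) ⊆ V(G) of original vertices it stands for.

record LGraph (m : ℕ) : Set₁ where
  field
    V   : Set
    E   : V → V → Set
    tot : V → Fin m → Set
open LGraph public

initial : (G : Graph) → LGraph (n G)
initial G = record { V = Fin (n G) ; E = Adj G ; tot = λ x g → x ≡ g }

-- H[S] plus a marker adjacent exactly to the vertices of S having a
-- neighbour in the complement Sc; tot(marker) = ⋃ tot over Sc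
half : {m : ℕ} (H : LGraph m) → (V H → Set) → (V H → Set) → LGraph m
half {m} H S Sc = record { V = V' ; E = E' ; tot = tot' }
  where
  V' : Set
  V' = Σ (V H) S ⊎ ⊤
  E' : V' → V' → Set
  E' (inj₁ x) (inj₁ y) = E H (proj₁ x) (proj₁ y)
  E' (inj₁ x) (inj₂ _) = HasNbrIn (E H) (proj₁ x) Sc
  E' (inj₂ _) (inj₁ y) = HasNbrIn (E H) (proj₁ y) Sc
  E' (inj₂ _) (inj₂ _) = ⊥
  tot' : V' → Fin m → Set
  tot' (inj₁ x) g = tot H (proj₁ x) g
  tot' (inj₂ _) g = Σ (V H) λ z → Sc z × tot H z g

data Step {m : ℕ} : List (LGraph m) → List (LGraph m) → Set₁ where
  split : (ps qs : List (LGraph m)) (H : LGraph m) (b : V H → Bool) →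
          IsSplit (V H) (E H) (λ x → T (b x)) →
          Step (ps ++ H ∷ qs)
               (ps ++ half H (λ x → T (b x)) (λ x → T (not (b x)))
                  ∷ half H (λ x → T (not (b x))) (λ x → T (b x)) ∷ qs)

Prime : {m : ℕ} → LGraph m → Set₁
Prime H = (V1 : V H → Set) → ¬ IsSplit (V H) (E H) V1

NonTrivial : {m : ℕ} → LGraph m → Set
NonTrivial H = AtLeast 4 (λ (_ : V H) → ⊤)

IsSplitDecomposition : (G : Graph) → List (LGraph (n G)) → Set₁
IsSplitDecomposition G Ls = Star Step (initial G ∷ []) Ls × All Prime Ls

-- act(v : P) = N_G(V(G) ∖ tot(v : P))
act : (G : Graph) (P : LGraph (n G)) → V P → Fin (n G) → Set
act G P v g = tot P v g × HasNbrIn (Adj G) g (λ h → ¬ tot P v h)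

actSet : (G : Graph) (P : LGraph (n G)) → (V P → Set) → Fin (n G) → Set
actSet G P V' g = Σ (V P) λ v → V' v × act G P v g

NbhdP : {m : ℕ} (P : LGraph m) → V P → V P → Set
NbhdP P a v = E P a v

module Submission where

-- The heart of the argument is an invariant of split decomposition: in every
-- graph H arising in the process, if a and b are adjacent in H then every
-- vertex of act(a : H) is adjacent in G to every vertex of act(b : H).  It
-- holds for G itself and is preserved by decomposing along a split, because
-- a split is "rectangular" (x ~ z and u ~ w across it force x ~ w).
--
-- Hence X ∩ act(a : P) is complete to Y ∩ act(N_P(a) : P); pairing k
-- vertices of each gives a matching of size k across (X , Y), so mm(X) ≥ k.
-- If (X , Y) were not a split then sm(X) = mm(X) ≥ k, contradicting the
-- width bound.  Constructively this yields only ¬ ¬ "split"; the sizes of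
-- both sides are given by the hypotheses and the remaining adjacency
-- conditions are decidable, so the split property is recovered exactly.

open import Defs
open import Data.Nat using (ℕ; _≤_)
open import Data.Fin using (Fin)
open import Data.List using (List; length; lookup)
open import Data.Product using (_×_)
open import Relation.Nullary using (¬_)

open import Data.Bool using (true; false; not; T)
open import Data.Fin.Properties using (pigeonhole; <⇒≢)
open import Data.List using ([]; _∷_; map; zip; take)
open import Data.List.Membership.Propositional.Properties using (∈-lookup)
open import Data.List.Properties using (length-map; length-take)
open import Data.List.Relation.Unary.All using (All; []; _∷_)
import Data.List.Relation.Unary.All as All
import Data.List.Relation.Unary.All.Properties as All
open import Data.List.Relation.Unary.AllPairs using ([]; _∷_)
import Data.List.Relation.Unary.AllPairs.Properties as AllPairs
open import Data.List.Relation.Unary.Unique.Propositional using (Unique)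
open import Data.Nat using (suc; _⊓_)
open import Data.Nat.Properties using (≤-trans; ≤-pred; ≤∧≢⇒<; <⇒≱; ≰⇒>; ⊓-glb; _≤?_)
open import Data.Product using (Σ; _,_; proj₁; proj₂)
open import Data.Sum using (_⊎_; inj₁; inj₂)
open import Data.Unit using (tt)
open import Relation.Binary.Construct.Closure.ReflexiveTransitive using (Star; ε; _◅_)
open import Relation.Binary.PropositionalEquality using (_≡_; refl; cong; subst; module ≡-Reasoning)
  renaming (sym to ≡-sym)
open import Relation.Nullary using (Stable; yes; no; contradiction; ¬¬-map)
open import Relation.Nullary.Decidable using (T?; decidable-stable; ¬¬-excluded-middle)

adj-sym : (G : Graph) {x y : Fin (n G)} → Adj G x y → Adj G y x
adj-sym G {x} {y} = subst T (Graph.sym G x y)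

record Faithful (G : Graph) (H : LGraph (n G)) : Set where
  field
    covers          : ∀ g → Σ (V H) λ v → tot H v g
    edge-sym        : ∀ a b → E H a b → E H b a
    edge-reflects   : ∀ a b g h → tot H a g → tot H b h → Adj G g h →
                      ¬ tot H a h → E H a b
    active-complete : ∀ a b g h → E H a b → act G H a g → act G H b h → Adj G g h
open Faithful

initial-faithful : (G : Graph) → Faithful G (initial G)
initial-faithful G = record
  { covers          = λ g → g , refl
  ; edge-sym        = λ a b → adj-sym G
  ; edge-reflects   = λ { a b g h refl refl gh _ → gh }
  ; active-complete = λ { a b g h ab (refl , _) (refl , _) → ab } }

Rectangular : {m : ℕ} (H : LGraph m) → (V H → Set) → (V H → Set) → Set
Rectangular H S Sc =
  ∀ x u z w → S x → S u → Sc z → Sc w → E H x z → E H u w → E H x w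

split-rectangular : {V' : Set} {R : V' → V' → Set} {V1 : V' → Set} →
                    IsSplit V' R V1 →
                    ∀ x u z w → V1 x → V1 u → ¬ V1 z → ¬ V1 w → R x z → R u w → R x w
split-rectangular (_ , _ , same-nbhd) x u z w x∈ u∈ z∉ w∉ xz uw =
  proj₁ (same-nbhd u x u∈ x∈ (w , w∉ , uw) (z , z∉ , xz) w w∉) uw

module HalfFaithful (G : Graph) (H : LGraph (n G)) (S Sc : V H → Set)
  (F : Faithful G H) (side : ∀ v → S v ⊎ Sc v) (rect : Rectangular H S Sc) where

  H' : LGraph (n G)
  H' = half H S Sc

  covers' : ∀ g → Σ (V H') λ v → tot H' v g
  covers' g with covers F g
  ... | v , g∈v with side v
  ... | inj₁ v∈S  = inj₁ (v , v∈S) , g∈v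
  ... | inj₂ v∈Sc = inj₂ tt , v , v∈Sc , g∈v

  edge-sym' : ∀ a b → E H' a b → E H' b a
  edge-sym' (inj₁ x) (inj₁ y) xy = edge-sym F _ _ xy
  edge-sym' (inj₁ x) (inj₂ _) xm = xm
  edge-sym' (inj₂ _) (inj₁ y) my = my
  edge-sym' (inj₂ _) (inj₂ _) ()

  edge-reflects' : ∀ a b g h → tot H' a g → tot H' b h → Adj G g h →
                   ¬ tot H' a h → E H' a b
  edge-reflects' (inj₁ x) (inj₁ y) g h g∈ h∈ gh h∉ =
    edge-reflects F (proj₁ x) (proj₁ y) g h g∈ h∈ gh h∉
  edge-reflects' (inj₁ x) (inj₂ _) g h g∈ (z , z∈Sc , h∈z) gh h∉ =
    z , z∈Sc , edge-reflects F (proj₁ x) z g h g∈ h∈z gh h∉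
  edge-reflects' (inj₂ _) (inj₁ y) g h (z , z∈Sc , g∈z) h∈ gh h∉ =
    z , z∈Sc , edge-sym F z (proj₁ y)
      (edge-reflects F z (proj₁ y) g h g∈z h∈ gh (λ h∈z → h∉ (z , z∈Sc , h∈z)))
  edge-reflects' (inj₂ _) (inj₂ _) g h _ (z , z∈Sc , h∈z) gh h∉ =
    contradiction (z , z∈Sc , h∈z) h∉

  -- An active vertex h of the marker lies in tot(z') for some z' ∈ Sc and
  -- has a G-neighbour outside all of Sc, hence in tot(u) for some u ∈ S;
  -- so z' ~ u, and rectangularity turns x ~ z into x ~ z'.
  marker-complete : ∀ (x : Σ (V H) S) g h → HasNbrIn (E H) (proj₁ x) Sc →
                    act G H (proj₁ x) g → act G H' (inj₂ tt) h → Adj G g h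
  marker-complete (x , x∈S) g h (z , z∈Sc , xz) g-act
                  ((z' , z'∈Sc , h∈z') , (w , w∉ , hw)) with covers F w
  ... | u , w∈u with side u
  ... | inj₂ u∈Sc = contradiction (u , u∈Sc , w∈u) w∉
  ... | inj₁ u∈S  = active-complete F x z' g h xz' g-act h-act
    where
    w∉z' : ¬ tot H z' w
    w∉z' w∈z' = w∉ (z' , z'∈Sc , w∈z')
    h-act : act G H z' h
    h-act = h∈z' , w , w∉z' , hw
    xz' : E H x z'
    xz' = rect x u z z' x∈S u∈S z∈Sc z'∈Sc xz
            (edge-sym F z' u (edge-reflects F z' u h w h∈z' w∈u hw w∉z'))

  active-complete' : ∀ a b g h → E H' a b → act G H' a g → act G H' b h → Adj G g h
  active-complete' (inj₁ x) (inj₁ y) g h xy = active-complete F _ _ g h xy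
  active-complete' (inj₁ x) (inj₂ _) g h xm g-act h-act =
    marker-complete x g h xm g-act h-act
  active-complete' (inj₂ _) (inj₁ y) g h my g-act h-act =
    adj-sym G (marker-complete y h g my h-act g-act)
  active-complete' (inj₂ _) (inj₂ _) g h ()

  faithful : Faithful G H'
  faithful = record
    { covers = covers' ; edge-sym = edge-sym' ; edge-reflects = edge-reflects'
    ; active-complete = active-complete' }

-- One decomposition step preserves faithfulness of all graphs in the list:
-- both sides of the split are rectangular (the second one by symmetry).
step-faithful : (G : Graph) {Hs Hs' : List (LGraph (n G))} →
                Step Hs Hs' → All (Faithful G) Hs → All (Faithful G) Hs'
step-faithful G (split ps qs H b sp) all-F with All.++⁻ʳ ps all-F
... | F ∷ F-qs = All.++⁺ (All.++⁻ˡ ps all-F)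
                   (HalfFaithful.faithful G H S₁ S₂ F side₁ rect₁
                  ∷ HalfFaithful.faithful G H S₂ S₁ F side₂ rect₂ ∷ F-qs)
  where
  S₁ S₂ : V H → Set
  S₁ x = T (b x)
  S₂ x = T (not (b x))
  not-S₁ : ∀ x → S₂ x → ¬ S₁ x
  not-S₁ x with b x
  ... | true  = λ ()
  ... | false = λ _ ()
  side₁ : ∀ x → S₁ x ⊎ S₂ x
  side₁ x with b x
  ... | true  = inj₁ tt
  ... | false = inj₂ tt
  side₂ : ∀ x → S₂ x ⊎ S₁ x
  side₂ x with b x
  ... | true  = inj₂ tt
  ... | false = inj₁ tt
  rect₁ : Rectangular H S₁ S₂
  rect₁ x u z w x∈ u∈ z∈ w∈ =
    split-rectangular sp x u z w x∈ u∈ (not-S₁ z z∈) (not-S₁ w w∈)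
  rect₂ : Rectangular H S₂ S₁
  rect₂ x u z w x∈ u∈ z∈ w∈ xz uw =
    edge-sym F w x (rect₁ w z u x w∈ z∈ u∈ x∈ (edge-sym F u w uw) (edge-sym F x z xz))

decomposition-faithful : (G : Graph) (Ls : List (LGraph (n G))) →
                         IsSplitDecomposition G Ls →
                         (i : Fin (length Ls)) → Faithful G (lookup Ls i)
decomposition-faithful G Ls (steps , _) i =
  All.lookup (run steps (initial-faithful G ∷ [])) (∈-lookup i)
  where
  run : ∀ {Hs Hs'} → Star Step Hs Hs' → All (Faithful G) Hs → All (Faithful G) Hs'
  run ε           F = F
  run (s ◅ steps) F = run steps (step-faithful G s F)

proj₁-zip : {A B : Set} (xs : List A) (ys : List B) →
            map proj₁ (zip xs ys) ≡ take (length ys) xs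
proj₁-zip []       []       = refl
proj₁-zip []       (_ ∷ _)  = refl
proj₁-zip (_ ∷ _)  []       = refl
proj₁-zip (x ∷ xs) (y ∷ ys) = cong (x ∷_) (proj₁-zip xs ys)

proj₂-zip : {A B : Set} (xs : List A) (ys : List B) →
            map proj₂ (zip xs ys) ≡ take (length xs) ys
proj₂-zip []       _        = refl
proj₂-zip (_ ∷ _)  []       = refl
proj₂-zip (x ∷ xs) (y ∷ ys) = cong (y ∷_) (proj₂-zip xs ys)

length-zip : {A B : Set} (xs : List A) (ys : List B) →
             length (zip xs ys) ≡ length ys ⊓ length xs
length-zip xs ys = begin
  length (zip xs ys)               ≡⟨ length-map proj₁ (zip xs ys) ⟨
  length (map proj₁ (zip xs ys))   ≡⟨ cong length (proj₁-zip xs ys) ⟩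
  length (take (length ys) xs)     ≡⟨ length-take (length ys) xs ⟩
  length ys ⊓ length xs            ∎
  where open ≡-Reasoning

complete-matching : (G : Graph) (A S R : Fin (n G) → Set) (k : ℕ) →
                    (∀ x y → S x → R y → Adj G x y) →
                    AtLeast k (λ x → A x × S x) → AtLeast k (λ y → ¬ A y × R y) →
                    Σ (List (Fin (n G) × Fin (n G))) λ M → IsMatching G A M × k ≤ length M
complete-matching G A S R k complete (xs , xs-uniq , xs-in , k≤xs) (ys , ys-uniq , ys-in , k≤ys) =
  M , (All.map cross-edge (All.zip (firsts-in , seconds-in)) , firsts-uniq , seconds-uniq) , k≤M
  where
  M : List (Fin (n G) × Fin (n G))
  M = zip xs ys
  firsts-in : All (λ e → A (proj₁ e) × S (proj₁ e)) M
  firsts-in = All.map⁻ (subst (All _) (≡-sym (proj₁-zip xs ys)) (All.take⁺ (length ys) xs-in))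
  seconds-in : All (λ e → ¬ A (proj₂ e) × R (proj₂ e)) M
  seconds-in = All.map⁻ (subst (All _) (≡-sym (proj₂-zip xs ys)) (All.take⁺ (length xs) ys-in))
  firsts-uniq : Unique (map proj₁ M)
  firsts-uniq = subst Unique (≡-sym (proj₁-zip xs ys)) (AllPairs.take⁺ (length ys) xs-uniq)
  seconds-uniq : Unique (map proj₂ M)
  seconds-uniq = subst Unique (≡-sym (proj₂-zip xs ys)) (AllPairs.take⁺ (length xs) ys-uniq)
  cross-edge : ∀ {e} → (A (proj₁ e) × S (proj₁ e)) × (¬ A (proj₂ e) × R (proj₂ e)) →
               A (proj₁ e) × ¬ A (proj₂ e) × Adj G (proj₁ e) (proj₂ e)
  cross-edge ((x∈A , Sx) , (y∉A , Ry)) = x∈A , y∉A , complete _ _ Sx Ry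
  k≤M : k ≤ length M
  k≤M = subst (k ≤_) (≡-sym (length-zip xs ys)) (⊓-glb k≤ys k≤xs)

unique-lookup-injective : {A : Set} {xs : List A} → Unique xs →
                          ∀ i j → lookup xs i ≡ lookup xs j → i ≡ j
unique-lookup-injective (_ ∷ _)        Fin.zero    Fin.zero    _  = refl
unique-lookup-injective (x∉xs ∷ _)     Fin.zero    (Fin.suc j) eq =
  contradiction eq (All.lookup x∉xs (∈-lookup j))
unique-lookup-injective (x∉xs ∷ _)     (Fin.suc i) Fin.zero    eq =
  contradiction (≡-sym eq) (All.lookup x∉xs (∈-lookup i))
unique-lookup-injective (_ ∷ xs-uniq)  (Fin.suc i) (Fin.suc j) eq =
  cong Fin.suc (unique-lookup-injective xs-uniq i j eq)

unique-length-bound : {m : ℕ} (xs : List (Fin m)) → Unique xs → length xs ≤ m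
unique-length-bound {m} xs xs-uniq with length xs ≤? m
... | yes bounded = bounded
... | no unbounded with pigeonhole (≰⇒> unbounded) (lookup xs)
... | i , j , i<j , eq = contradiction (unique-lookup-injective xs-uniq i j eq) (<⇒≢ i<j)

-- A set of naturals containing 0 and bounded by c has a maximum, up to
-- double negation (membership need not be decidable).
¬¬-maximum : (Q : ℕ → Set) → Q 0 → (c : ℕ) → (∀ m → Q m → m ≤ c) →
             ¬ ¬ Σ ℕ λ s → Q s × (∀ m → Q m → m ≤ s)
¬¬-maximum Q Q0 ℕ.zero    bound = λ no-max → no-max (0 , Q0 , bound)
¬¬-maximum Q Q0 (suc c)   bound no-max = ¬¬-excluded-middle λ
  { (yes Qc) → no-max (suc c , Qc , bound)
  ; (no ¬Qc) → ¬¬-maximum Q Q0 c (λ m Qm → ≤-pred (≤∧≢⇒< (bound m Qm)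
                 (λ { refl → ¬Qc Qm }))) no-max }

-- mm(A) exists (up to double negation): matchings have at most |V(G)| edges.
¬¬-mm : (G : Graph) (A : Fin (n G) → Set) → ¬ ¬ Σ ℕ (IsMM G A)
¬¬-mm G A = ¬¬-map as-mm (¬¬-maximum Size ([] , ([] , [] , []) , refl) (n G) bounded)
  where
  Size : ℕ → Set
  Size m = Σ (List (Fin (n G) × Fin (n G))) λ M → IsMatching G A M × length M ≡ m
  bounded : ∀ m → Size m → m ≤ n G
  bounded m (M , (_ , firsts-uniq , _) , refl) =
    subst (_≤ n G) (length-map proj₁ M) (unique-length-bound (map proj₁ M) firsts-uniq)
  as-mm : (Σ ℕ λ s → Size s × (∀ m → Size m → m ≤ s)) → Σ ℕ (IsMM G A)
  as-mm (s , size , max) = s , size , λ M M-matching → max (length M) (M , M-matching , refl)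

module _ (G : Graph) (B : BranchDecomposition G) (k : ℕ) (width : SmWidthLess G B k)
         (p q : Fin (n (Tr B))) (pq : Adj (Tr B) p q) where

  -- A split cut has sm = 1, so a width bound below k forces k ≥ 2.
  split-cut-width : IsSplitG G (CutSide G B p q) → 2 ≤ k
  split-cut-width is-split = width p q pq 1 (inj₁ (is-split , refl))

  -- A cut carrying a matching of size ≥ k cannot fail to be a split, since
  -- otherwise sm = mm ≥ k.
  ¬¬-split-of-matching : (Σ (List (Fin (n G) × Fin (n G))) λ M →
                            IsMatching G (CutSide G B p q) M × k ≤ length M) →
                         ¬ ¬ IsSplitG G (CutSide G B p q)
  ¬¬-split-of-matching (M , M-matching , k≤M) not-split =
    ¬¬-mm G (CutSide G B p q) λ { (s , mm) →
      <⇒≱ (width p q pq s (inj₂ (not-split , mm))) (≤-trans k≤M (proj₂ mm M M-matching)) }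

AtLeast-mono : {A : Set} {S S' : A → Set} {j k : ℕ} →
               (∀ x → S x → S' x) → j ≤ k → AtLeast k S → AtLeast j S'
AtLeast-mono S⊆S' j≤k (xs , xs-uniq , xs-in , k≤xs) =
  xs , xs-uniq , All.map (S⊆S' _) xs-in , ≤-trans j≤k k≤xs

IsSplit-stable : {V' : Set} (R : V' → V' → Set) (V1 : V' → Set) →
                 (∀ x y → Stable (R x y)) →
                 AtLeast 2 V1 → AtLeast 2 (λ x → ¬ V1 x) →
                 Stable (IsSplit V' R V1)
IsSplit-stable R V1 R-stable big₁ big₂ ¬¬split =
  big₁ , big₂ , λ x y x∈ y∈ x-across y-across z z∉ →
    (λ xz → R-stable y z (¬¬-map (λ { (_ , _ , same-nbhd) →
       proj₁ (same-nbhd x y x∈ y∈ x-across y-across z z∉) xz }) ¬¬split))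
  , (λ yz → R-stable x z (¬¬-map (λ { (_ , _ , same-nbhd) →
       proj₂ (same-nbhd x y x∈ y∈ x-across y-across z z∉) yz }) ¬¬split))

lemma2 : (G : Graph) → Connected G →
         (Ls : List (LGraph (n G))) → IsSplitDecomposition G Ls →
         (i : Fin (length Ls)) → NonTrivial (lookup Ls i) →
         (k : ℕ) → 1 ≤ k →
         (B : BranchDecomposition G) → SmWidthLess G B k →
         (a : V (lookup Ls i)) →
         (p q : Fin (n (Tr B))) → Adj (Tr B) p q →
         AtLeast k (λ g → CutSide G B p q g × act G (lookup Ls i) a g) →
         AtLeast k (λ g → ¬ CutSide G B p q g × actSet G (lookup Ls i) (NbhdP (lookup Ls i) a) g) →
         IsSplitG G (CutSide G B p q)
lemma2 G _ Ls decomp i _ k _ B width a p q pq X-act Y-act =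
  IsSplit-stable (Adj G) X (λ x y → decidable-stable (T? (adj G x y)))
    (AtLeast-mono (λ _ → proj₁) 2≤k X-act) (AtLeast-mono (λ _ → proj₁) 2≤k Y-act) ¬¬split
  where
  P : LGraph (n G)
  P = lookup Ls i
  X : Fin (n G) → Set
  X = CutSide G B p q
  complete : ∀ x y → act G P a x → actSet G P (NbhdP P a) y → Adj G x y
  complete x y x-act (v , av , y-act) =
    active-complete (decomposition-faithful G Ls decomp i) a v x y av x-act y-act
  ¬¬split : ¬ ¬ IsSplitG G X
  ¬¬split = ¬¬-split-of-matching G B k width p q pq
    (complete-matching G X (act G P a) (actSet G P (NbhdP P a)) k complete X-act Y-act)
  2≤k : 2 ≤ k
  2≤k = decidable-stable (2 ≤? k) (¬¬-map (split-cut-width G B k width p q pq) ¬¬split)
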